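{- Let $F$ be a forest with no isolated vertices. Then $$\frac14\big(|\mathit{Deg}_{\ge2}(F)|+|\mathit{Supp}(F)|\big)\le\gamma(F)\le\frac12\big(|\mathit{Deg}_{\ge2}(F)|+|\mathit{Supp}(F)|\big).$$
   Context: $\gamma(F)$ is the domination number (size of a minimum dominating set) of $F$. $\mathit{Deg}_{\ge2}(F)$ is the set of vertices of degree at least $2$. $\mathit{Supp}(F)$ is the set of support vertices, i.e., vertices adjacent to at least one leaf (vertex of degree $1$). -}

module Defs where

open import Data.Nat using (ℕ; _≤_; _+_; _*_)
open import Data.Bool using (Bool; true; false; T; _∧_)
open import Data.Bool.Properties using (T?)
open import Data.Fin using (Fin)
open import Data.Fin.Subset using (Subset; _∈_; ∣_∣)
open import Data.List using (List; []; _∷_; _++_; [_]; length; filter; allFin)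
open import Data.Bool.ListAction using (any)
open import Data.List.Relation.Unary.Linked using (Linked)
open import Data.List.Relation.Unary.Unique.Propositional using (Unique)
open import Data.Product using (Σ; _×_; ∃)
open import Data.Sum using (_⊎_)
open import Relation.Binary.PropositionalEquality using (_≡_)
open import Relation.Nullary using (¬_)
open import Data.Nat using (_≟_; _≤?_)
open import Relation.Nullary.Decidable using (does)

record Graph (n : ℕ) : Set where
  field
    adj   : Fin n → Fin n → Bool
    sym   : ∀ u v → adj u v ≡ adj v u
    irrefl : ∀ v → adj v v ≡ false

module _ {n : ℕ} (G : Graph n) where
  open Graph G

  Adj : Fin n → Fin n → Set
  Adj u v = T (adj u v)

  -- a cycle: distinct vertices x, m₁, …, mₖ, y (k ≥ 1, so at least 3 vertices),
  -- consecutive ones adjacent, and y adjacent to x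
  Cycle : Set
  Cycle = Σ (Fin n) λ x → Σ (List (Fin n)) λ mid → Σ (Fin n) λ y →
            1 ≤ length mid
          × Unique (x ∷ mid ++ [ y ])
          × Linked Adj (x ∷ mid ++ [ y ])
          × Adj y x

  IsForest : Set
  IsForest = ¬ Cycle

  deg : Fin n → ℕ
  deg v = length (filter (λ u → T? (adj v u)) (allFin n))

  NoIsolated : Set
  NoIsolated = ∀ v → ¬ (deg v ≡ 0)

  isLeaf : Fin n → Bool
  isLeaf v = does (deg v ≟ 1)

  numDeg≥2 : ℕ
  numDeg≥2 = length (filter (λ v → 2 ≤? deg v) (allFin n))

  isSupport : Fin n → Bool
  isSupport v = any (λ u → adj v u ∧ isLeaf u) (allFin n)

  numSupp : ℕ
  numSupp = length (filter (λ v → T? (isSupport v)) (allFin n))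

  Dominating : Subset n → Set
  Dominating D = ∀ v → v ∈ D ⊎ ∃ λ u → u ∈ D × Adj u v

  IsDominationNumber : ℕ → Set
  IsDominationNumber γ =
    (Σ (Subset n) λ D → Dominating D × ∣ D ∣ ≡ γ)
    × (∀ D → Dominating D → γ ≤ ∣ D ∣)

-- Upper bound: call a vertex core if it has degree ≥ 2 and is a support vertex, an outer leaf if it is
-- a leaf but no support vertex, and free otherwise. For every set X of free vertices, C ∪ X and
-- C ∪ (free ∖ X), where C is the set of core vertices, have sizes adding up to |Deg≥2| + |Supp|. Every
-- outer leaf hangs on a core vertex, so if X is minimal with C ∪ X dominating, each v ∈ X has a private
-- neighbour, which is free and outside X; hence both sets dominate and 2γ ≤ |Deg≥2| + |Supp|.
--
-- Lower bound: for a dominating set D let D⁺ consist of D and the neighbours of leaves in D, let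
-- X = Deg≥2 ∩ D⁺ and let P be the set of ends of K₂ components. Then |Supp| ≤ |X| + |P|, and charging
-- gives |X| ≤ |D ∖ P| and |P| ≤ 2|D ∩ P|. A vertex of Deg≥2 ∖ D⁺ has at least two neighbours in Deg≥2,
-- one of them in X; as the forest induced on Deg≥2 has no more edges than vertices, |Deg≥2 ∖ D⁺| ≤ 2|X|.
-- Hence |Deg≥2| + |Supp| ≤ 4|X| + |P| ≤ 2(2|X| + |P|) ≤ 4|D|.

module Submission where

open import Defs
open import Data.Bool using (Bool; true; false; T; _∧_; _∨_; not)
open import Data.Bool.Properties using (∧-identityʳ; T-≡)
open import Data.Empty using (⊥-elim)
open import Data.Fin using (Fin; zero; suc; _≟_)
open import Data.Fin.Properties using (any?; all?; ¬∀⟶∃¬; suc-injective)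
open import Data.Fin.Subset using (Subset; ∣_∣; _∈_)
open import Data.List using (List; []; _∷_; _++_; [_]; length; filter; tabulate; allFin)
open import Data.List.Properties using (++-assoc)
open import Data.List.Membership.Propositional using () renaming (_∈_ to _∈ˡ_; _∉_ to _∉ˡ_)
open import Data.List.Membership.Propositional.Properties using (∈-∃++)
open import Data.List.Relation.Unary.All using ([])
open import Data.List.Relation.Unary.All.Properties as All using (¬Any⇒All¬)
open import Data.List.Relation.Unary.AllPairs using (AllPairs; []; _∷_)
open import Data.List.Relation.Unary.Any using (here; there)
open import Data.List.Relation.Unary.Any.Properties using (any⁺; any⁻; tabulate⁺; tabulate⁻)
open import Data.List.Relation.Unary.Linked using (Linked; []; [-]; _∷_)
open import Data.List.Relation.Unary.Unique.Propositional using (Unique)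
open import Data.Nat using (ℕ; zero; suc; _+_; _*_; _≤_; _<_; z≤n; s≤s; _≤?_) renaming (_≟_ to _≟ℕ_)
open import Data.Nat.Induction using (<-wellFounded)
open import Data.Nat.Properties hiding (suc-injective; _≟_)
open import Data.Nat.Tactic.RingSolver using (solve-∀)
open import Algebra.Properties.CommutativeMonoid.Sum +-0-commutativeMonoid
  using (sum; sum-syntax; sum-cong-≗; ∑-distrib-+; ∑-comm)
open import Data.Product using (_×_; _,_; ∃; proj₁; proj₂)
open import Data.Sum using (_⊎_; inj₁; inj₂)
open import Data.Vec as Vec using ([]; _∷_; lookup)
open import Data.Vec.Properties using (lookup∘tabulate; []=⇒lookup; lookup⇒[]=)
open import Function using (_∘_; id; Equivalence)
open import Induction.WellFounded using (Acc; acc)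
open import Relation.Binary.PropositionalEquality hiding ([_])
open import Relation.Nullary using (¬_; yes; no; does)
open import Relation.Nullary.Decidable using (Dec; T?; ¬?; dec-true; decidable-stable; _⊎-dec_; _×-dec_)
open import Relation.Unary using (Decidable)

∧-intro : ∀ {a b} → T a → T b → T (a ∧ b)
∧-intro {true} _ b = b

∧-elimˡ : ∀ {a b} → T (a ∧ b) → T a
∧-elimˡ {true} _ = _

∧-elimʳ : ∀ {a b} → T (a ∧ b) → T b
∧-elimʳ {true} b = b

∨-introˡ : ∀ {a b} → T a → T (a ∨ b)
∨-introˡ {true} _ = _

∨-introʳ : ∀ {a b} → T b → T (a ∨ b)
∨-introʳ {true} _ = _
∨-introʳ {false} b = b

∨-elim : ∀ {a b} → T (a ∨ b) → T a ⊎ T b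
∨-elim {true} a = inj₁ a
∨-elim {false} b = inj₂ b

not-intro : ∀ {a} → ¬ T a → T (not a)
not-intro {false} _ = _
not-intro {true} ¬a = ¬a _

not-elim : ∀ {a} → T (not a) → ¬ T a
not-elim {true} ()

does-sound : ∀ {P : Set} (P? : Dec P) → T (does P?) → P
does-sound (yes p) _ = p

does-complete : ∀ {P : Set} (P? : Dec P) → P → T (does P?)
does-complete P? p rewrite dec-true P? p = _

⟦_⟧ : Bool → ℕ
⟦ true ⟧ = 1
⟦ false ⟧ = 0

⟦⟧≡1 : ∀ {b} → T b → ⟦ b ⟧ ≡ 1
⟦⟧≡1 {true} _ = refl

⟦⟧≡0 : ∀ {b} → ¬ T b → ⟦ b ⟧ ≡ 0
⟦⟧≡0 {true} ¬b = ⊥-elim (¬b _)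
⟦⟧≡0 {false} _ = refl

⟦⟧-mono : ∀ {a b} → (T a → T b) → ⟦ a ⟧ ≤ ⟦ b ⟧
⟦⟧-mono {false} _ = z≤n
⟦⟧-mono {true} a⇒b rewrite ⟦⟧≡1 (a⇒b _) = ≤-refl

sum-mono-≤ : ∀ {n} {f g : Fin n → ℕ} → (∀ i → f i ≤ g i) → sum f ≤ sum g
sum-mono-≤ {zero} f≤g = z≤n
sum-mono-≤ {suc n} f≤g = +-mono-≤ (f≤g zero) (sum-mono-≤ (f≤g ∘ suc))

sum-mono-< : ∀ {n} {f g : Fin n → ℕ} → (∀ i → f i ≤ g i) → ∀ v → f v < g v → sum f < sum g
sum-mono-< f≤g zero fv<gv = +-mono-<-≤ fv<gv (sum-mono-≤ (f≤g ∘ suc))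
sum-mono-< f≤g (suc v) fv<gv = +-mono-≤-< (f≤g zero) (sum-mono-< (f≤g ∘ suc) v fv<gv)

≤-sum : ∀ {n} (f : Fin n → ℕ) v → f v ≤ sum f
≤-sum f zero = m≤m+n _ _
≤-sum f (suc v) = ≤-trans (≤-sum (f ∘ suc) v) (m≤n+m _ _)

sum-zero : ∀ {n} {f : Fin n → ℕ} → (∀ i → f i ≡ 0) → sum f ≡ 0
sum-zero {zero} f≡0 = refl
sum-zero {suc n} f≡0 rewrite f≡0 zero = sum-zero (f≡0 ∘ suc)

sum-single : ∀ {n} {f : Fin n → ℕ} v → (∀ i → i ≢ v → f i ≡ 0) → sum f ≡ f v
sum-single {f = f} zero others≡0 =
  trans (cong (f zero +_) (sum-zero (λ i → others≡0 (suc i) (λ ())))) (+-identityʳ _)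
sum-single (suc v) others≡0 rewrite others≡0 zero (λ ()) =
  sum-single v (λ i i≢v → others≡0 (suc i) (i≢v ∘ suc-injective))

∑∑-distrib-+ : ∀ {m n} (f g : Fin m → Fin n → ℕ) →
               ∑[ i < m ] ∑[ j < n ] (f i j + g i j) ≡ ∑[ i < m ] ∑[ j < n ] f i j + ∑[ i < m ] ∑[ j < n ] g i j
∑∑-distrib-+ f g = trans (sum-cong-≗ (λ i → ∑-distrib-+ (f i) (g i))) (∑-distrib-+ (λ i → sum (f i)) _)

count : ∀ {n} → (Fin n → Bool) → ℕ
count {n} p = ∑[ i < n ] ⟦ p i ⟧

_⊆_ : ∀ {n} → (Fin n → Bool) → (Fin n → Bool) → Set
p ⊆ q = ∀ i → T (p i) → T (q i)

count-mono : ∀ {n} {p q : Fin n → Bool} → p ⊆ q → count p ≤ count q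
count-mono p⇒q = sum-mono-≤ (λ i → ⟦⟧-mono (p⇒q i))

count-zero : ∀ {n} {p : Fin n → Bool} → (∀ i → ¬ T (p i)) → count p ≡ 0
count-zero ¬p = sum-zero (λ i → ⟦⟧≡0 (¬p i))

count-witness : ∀ {n} (p : Fin n → Bool) → 0 < count p → ∃ λ i → T (p i)
count-witness p 0<count with any? (T? ∘ p)
... | yes witness = witness
... | no none = ⊥-elim (<⇒≢ 0<count (sym (count-zero (λ i pi → none (i , pi)))))

count-≤1 : ∀ {n} {p : Fin n → Bool} → (∀ i j → T (p i) → T (p j) → i ≡ j) → count p ≤ 1
count-≤1 {p = p} unique with any? (T? ∘ p)
... | no none = ≤-trans (≤-reflexive (count-zero (λ i pi → none (i , pi)))) z≤n
... | yes (v , pv) = begin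
  count p  ≡⟨ sum-single v (λ i i≢v → ⟦⟧≡0 (λ pi → i≢v (unique i v pi pv))) ⟩
  ⟦ p v ⟧  ≡⟨ ⟦⟧≡1 pv ⟩
  1        ∎
  where open ≤-Reasoning

count-≤-⟦⟧ : ∀ {n} {p : Fin n → Bool} {b} →
             (∀ i j → T (p i) → T (p j) → i ≡ j) → (∀ i → T (p i) → T b) → count p ≤ ⟦ b ⟧
count-≤-⟦⟧ {p = p} {b} unique p⇒b with T? b
... | yes b-true = ≤-trans (count-≤1 unique) (≤-reflexive (sym (⟦⟧≡1 b-true)))
... | no b-false = ≤-reflexive (trans (count-zero (λ i → b-false ∘ p⇒b i)) (sym (⟦⟧≡0 b-false)))

count-split : ∀ {n} (p q : Fin n → Bool) →
              count p ≡ count (λ i → p i ∧ q i) + count (λ i → p i ∧ not (q i))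
count-split p q = trans (sum-cong-≗ (λ i → split (p i) (q i))) (∑-distrib-+ (λ i → ⟦ p i ∧ q i ⟧) _)
  where
  split : ∀ a b → ⟦ a ⟧ ≡ ⟦ a ∧ b ⟧ + ⟦ a ∧ not b ⟧
  split false b = refl
  split true false = refl
  split true true = refl

count-at : ∀ {n} (p : Fin n → Bool) v → count (λ i → p i ∧ does (i ≟ v)) ≡ ⟦ p v ⟧
count-at p v = begin
  count (λ i → p i ∧ does (i ≟ v))
    ≡⟨ sum-single v (λ i i≢v → ⟦⟧≡0 (i≢v ∘ does-sound (i ≟ v) ∘ ∧-elimʳ {p i})) ⟩
  ⟦ p v ∧ does (v ≟ v) ⟧
    ≡⟨ cong (λ b → ⟦ p v ∧ b ⟧) (dec-true (v ≟ v) refl) ⟩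
  ⟦ p v ∧ true ⟧
    ≡⟨ cong ⟦_⟧ (∧-identityʳ (p v)) ⟩
  ⟦ p v ⟧ ∎
  where open ≡-Reasoning

_∖_ : ∀ {n} → (Fin n → Bool) → Fin n → Fin n → Bool
(p ∖ v) i = p i ∧ not (does (i ≟ v))

count-remove : ∀ {n} (p : Fin n → Bool) {v} → T (p v) → count p ≡ suc (count (p ∖ v))
count-remove p {v} pv = begin
  count p                                        ≡⟨ count-split p (λ i → does (i ≟ v)) ⟩
  count (λ i → p i ∧ does (i ≟ v)) + count (p ∖ v) ≡⟨ cong (_+ count (p ∖ v)) (count-at p v) ⟩
  ⟦ p v ⟧ + count (p ∖ v)                        ≡⟨ cong (_+ count (p ∖ v)) (⟦⟧≡1 pv) ⟩
  suc (count (p ∖ v))                            ∎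
  where open ≡-Reasoning

minimal-subset : ∀ {n} (P : (Fin n → Bool) → Set) → (∀ X → Dec (P X)) → ∀ {X₀} → P X₀ →
                 ∃ λ X → X ⊆ X₀ × P X × (∀ v → T (X v) → ¬ P (X ∖ v))
minimal-subset {n} P P? {X₀} PX₀ = shrink X₀ (λ _ → id) PX₀ (<-wellFounded (count X₀))
  where
  shrink : ∀ X → X ⊆ X₀ → P X → Acc _<_ (count X) →
           ∃ λ X → X ⊆ X₀ × P X × (∀ v → T (X v) → ¬ P (X ∖ v))
  shrink X X⊆X₀ PX (acc smaller) with any? (λ v → T? (X v) ×-dec P? (X ∖ v))
  ... | no none = X , X⊆X₀ , PX , λ v Xv PX∖v → none (v , Xv , PX∖v)
  ... | yes (v , Xv , PX∖v) = shrink (X ∖ v) (λ u → X⊆X₀ u ∘ ∧-elimˡ) PX∖v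
                                      (smaller (≤-reflexive (sym (count-remove X Xv))))

count-≥2 : ∀ {n} {p : Fin n → Bool} {a b} → a ≢ b → T (p a) → T (p b) → 2 ≤ count p
count-≥2 {p = p} {a} {b} a≢b pa pb = begin
  2                                                ≡⟨ cong₂ _+_ (⟦⟧≡1 pa) (⟦⟧≡1 pb∖a) ⟨
  ⟦ p a ⟧ + ⟦ (p ∖ a) b ⟧                          ≤⟨ +-monoʳ-≤ ⟦ p a ⟧ (≤-sum (λ i → ⟦ (p ∖ a) i ⟧) b) ⟩
  ⟦ p a ⟧ + count (p ∖ a)                          ≡⟨ cong (_+ count (p ∖ a)) (count-at p a) ⟨
  count (λ i → p i ∧ does (i ≟ a)) + count (p ∖ a) ≡⟨ count-split p (λ i → does (i ≟ a)) ⟨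
  count p                                          ∎
  where
  open ≤-Reasoning
  pb∖a : T ((p ∖ a) b)
  pb∖a = ∧-intro pb (not-intro (a≢b ∘ sym ∘ does-sound (b ≟ a)))

double-count : ∀ {n m} {p : Fin n → Bool} (R : Fin n → Fin m → Bool) (b : Fin m → ℕ) →
               (∀ i → T (p i) → ∃ λ j → T (R i j)) → (∀ j → count (λ i → R i j) ≤ b j) →
               count p ≤ sum b
double-count {n} {m} {p} R b covered load = begin
  count p                            ≤⟨ sum-mono-≤ row ⟩
  ∑[ i < n ] ∑[ j < m ] ⟦ R i j ⟧    ≡⟨ ∑-comm (λ i j → ⟦ R i j ⟧) ⟩
  ∑[ j < m ] count (λ i → R i j)     ≤⟨ sum-mono-≤ load ⟩
  sum b                              ∎
  where
  open ≤-Reasoning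
  row : ∀ i → ⟦ p i ⟧ ≤ count (R i)
  row i with T? (p i)
  ... | no ¬pi = ≤-trans (≤-reflexive (⟦⟧≡0 ¬pi)) z≤n
  ... | yes pi = let (j , Rij) = covered i pi in begin
    ⟦ p i ⟧    ≡⟨ ⟦⟧≡1 pi ⟩
    1          ≡⟨ ⟦⟧≡1 Rij ⟨
    ⟦ R i j ⟧  ≤⟨ ≤-sum (λ j → ⟦ R i j ⟧) j ⟩
    count (R i) ∎

length-filter-tabulate : ∀ {n} {A : Set} {P : A → Set} (P? : Decidable P) (g : Fin n → A) →
                         length (filter P? (tabulate g)) ≡ ∑[ i < n ] ⟦ does (P? (g i)) ⟧
length-filter-tabulate {zero} P? g = refl
length-filter-tabulate {suc n} P? g with does (P? (g zero))
... | true = cong suc (length-filter-tabulate P? (g ∘ suc))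
... | false = length-filter-tabulate P? (g ∘ suc)

∣∣≡count-lookup : ∀ {n} (D : Subset n) → ∣ D ∣ ≡ count (lookup D)
∣∣≡count-lookup [] = refl
∣∣≡count-lookup (true ∷ D) = cong suc (∣∣≡count-lookup D)
∣∣≡count-lookup (false ∷ D) = ∣∣≡count-lookup D

∈⇒T : ∀ {n} {D : Subset n} {v} → v ∈ D → T (lookup D v)
∈⇒T v∈D rewrite []=⇒lookup v∈D = _

T⇒∈ : ∀ {n} {p : Fin n → Bool} {v} → T (p v) → v ∈ Vec.tabulate p
T⇒∈ {p = p} {v} pv = lookup⇒[]= v (Vec.tabulate p) (trans (lookup∘tabulate p v) (Equivalence.to T-≡ pv))

∣tabulate∣≡count : ∀ {n} (p : Fin n → Bool) → ∣ Vec.tabulate p ∣ ≡ count p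
∣tabulate∣≡count p = trans (∣∣≡count-lookup (Vec.tabulate p)) (sum-cong-≗ (cong ⟦_⟧ ∘ lookup∘tabulate p))

module _ {n : ℕ} (F : Graph n) where
  open Graph F using (adj; irrefl)

  Adj-sym : ∀ {u v} → Adj F u v → Adj F v u
  Adj-sym {u} {v} uv rewrite Graph.sym F u v = uv

  Adj-irrefl : ∀ {u v} → Adj F u v → u ≢ v
  Adj-irrefl {u} uu refl rewrite irrefl u = uu

  isDeg≥2 : Fin n → Bool
  isDeg≥2 v = does (2 ≤? deg F v)

  deg≡count : ∀ v → deg F v ≡ count (adj v)
  deg≡count v = length-filter-tabulate (λ u → T? (adj v u)) id

  numDeg≥2≡count : numDeg≥2 F ≡ count isDeg≥2
  numDeg≥2≡count = length-filter-tabulate (λ v → 2 ≤? deg F v) id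

  numSupp≡count : numSupp F ≡ count (isSupport F)
  numSupp≡count = length-filter-tabulate (λ v → T? (isSupport F v)) id

  support⇒leaf-neighbour : ∀ {v} → T (isSupport F v) → ∃ λ u → Adj F v u × T (isLeaf F u)
  support⇒leaf-neighbour {v} supp with tabulate⁻ (any⁻ (λ u → adj v u ∧ isLeaf F u) (allFin n) supp)
  ... | u , vu∧leaf = u , ∧-elimˡ vu∧leaf , ∧-elimʳ {adj v u} vu∧leaf

  leaf-neighbour⇒support : ∀ {v u} → Adj F v u → T (isLeaf F u) → T (isSupport F v)
  leaf-neighbour⇒support {v} {u} vu leaf =
    any⁺ (λ u → adj v u ∧ isLeaf F u) (tabulate⁺ u (∧-intro vu leaf))

  leaf⇒deg≡1 : ∀ {v} → T (isLeaf F v) → deg F v ≡ 1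
  leaf⇒deg≡1 {v} = does-sound (deg F v ≟ℕ 1)

  deg≥2⇒¬leaf : ∀ {v} → T (isDeg≥2 v) → ¬ T (isLeaf F v)
  deg≥2⇒¬leaf {v} deg≥2 leaf with does-sound (2 ≤? deg F v) deg≥2
  ... | 2≤deg rewrite leaf⇒deg≡1 leaf with 2≤deg
  ... | s≤s ()

  leaf-neighbour-unique : ∀ {v a b} → T (isLeaf F v) → Adj F v a → Adj F v b → a ≡ b
  leaf-neighbour-unique {v} {a} {b} leaf va vb with a ≟ b
  ... | yes a≡b = a≡b
  ... | no a≢b = ⊥-elim (<⇒≱ (subst (2 ≤_) (sym (deg≡count v)) (count-≥2 a≢b va vb))
                               (≤-reflexive (leaf⇒deg≡1 leaf)))

  Dominatingᵇ : (Fin n → Bool) → Set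
  Dominatingᵇ D = ∀ v → T (D v) ⊎ ∃ λ u → T (D u) × Adj F u v

  Dominatingᵇ? : ∀ D → Dec (Dominatingᵇ D)
  Dominatingᵇ? D = all? (λ v → T? (D v) ⊎-dec any? (λ u → T? (D u) ×-dec T? (adj u v)))

  Dominating⇒Dominatingᵇ : ∀ {D} → Dominating F D → Dominatingᵇ (lookup D)
  Dominating⇒Dominatingᵇ dom v with dom v
  ... | inj₁ v∈D = inj₁ (∈⇒T v∈D)
  ... | inj₂ (u , u∈D , uv) = inj₂ (u , ∈⇒T u∈D , uv)

  Dominatingᵇ⇒Dominating : ∀ {D} → Dominatingᵇ D → Dominating F (Vec.tabulate D)
  Dominatingᵇ⇒Dominating {D} dom v with dom v
  ... | inj₁ Dv = inj₁ (T⇒∈ Dv)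
  ... | inj₂ (u , Du , uv) = inj₂ (u , T⇒∈ Du , uv)

  degIn : (Fin n → Bool) → Fin n → ℕ
  degIn W v = count (λ u → W u ∧ adj v u)

  adjacentIn : (Fin n → Bool) → Fin n → Fin n → Bool
  adjacentIn W x y = W x ∧ (W y ∧ adj x y)

  -- ordered pairs, i.e. twice the number of edges of the subgraph induced on W
  pairs : (Fin n → Bool) → ℕ
  pairs W = ∑[ x < n ] count (adjacentIn W x)

  adjacentIn-sym : ∀ W x y → adjacentIn W x y ≡ adjacentIn W y x
  adjacentIn-sym W x y rewrite Graph.sym F x y with W x | W y
  ... | true | true = refl
  ... | true | false = refl
  ... | false | true = refl
  ... | false | false = refl

  pairs-through : ∀ W {v} → T (W v) → ∑[ x < n ] ∑[ y < n ] ⟦ does (x ≟ v) ∧ adjacentIn W x y ⟧ ≡ degIn W v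
  pairs-through W {v} Wv = begin
    ∑[ x < n ] ∑[ y < n ] ⟦ does (x ≟ v) ∧ adjacentIn W x y ⟧  ≡⟨ sum-single v other-rows-vanish ⟩
    ∑[ y < n ] ⟦ does (v ≟ v) ∧ (W v ∧ (W y ∧ adj v y)) ⟧      ≡⟨ sum-cong-≗ (λ y → cong ⟦_⟧ (v-row y)) ⟩
    degIn W v                                                ∎
    where
    open ≡-Reasoning
    other-rows-vanish : ∀ x → x ≢ v → count (λ y → does (x ≟ v) ∧ adjacentIn W x y) ≡ 0
    other-rows-vanish x x≢v =
      count-zero {p = λ y → does (x ≟ v) ∧ adjacentIn W x y} (λ y → x≢v ∘ does-sound (x ≟ v) ∘ ∧-elimˡ)
    v-row : ∀ y → does (v ≟ v) ∧ (W v ∧ (W y ∧ adj v y)) ≡ W y ∧ adj v y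
    v-row y = cong₂ (λ a b → a ∧ (b ∧ (W y ∧ adj v y))) (dec-true (v ≟ v) refl) (Equivalence.to T-≡ Wv)

  pairs-∖ : ∀ W {v} → T (W v) → pairs W ≤ pairs (W ∖ v) + (degIn W v + degIn W v)
  pairs-∖ W {v} Wv = begin
    pairs W
      ≤⟨ sum-mono-≤ (λ x → sum-mono-≤ (split x)) ⟩
    ∑[ x < n ] ∑[ y < n ] (⟦ adjacentIn (W ∖ v) x y ⟧ + (⟦ from-v x y ⟧ + ⟦ to-v x y ⟧))
      ≡⟨ ∑∑-distrib-+ (λ x y → ⟦ adjacentIn (W ∖ v) x y ⟧) _ ⟩
    pairs (W ∖ v) + ∑[ x < n ] ∑[ y < n ] (⟦ from-v x y ⟧ + ⟦ to-v x y ⟧)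
      ≡⟨ cong (pairs (W ∖ v) +_) (∑∑-distrib-+ (λ x y → ⟦ from-v x y ⟧) _) ⟩
    pairs (W ∖ v) + (∑[ x < n ] ∑[ y < n ] ⟦ from-v x y ⟧ + ∑[ x < n ] ∑[ y < n ] ⟦ to-v x y ⟧)
      ≡⟨ cong (pairs (W ∖ v) +_) (cong₂ _+_ (pairs-through W Wv) column) ⟩
    pairs (W ∖ v) + (degIn W v + degIn W v) ∎
    where
    open ≤-Reasoning
    from-v to-v : Fin n → Fin n → Bool
    from-v x y = does (x ≟ v) ∧ adjacentIn W x y
    to-v x y = does (y ≟ v) ∧ adjacentIn W x y
    split : ∀ x y → ⟦ adjacentIn W x y ⟧ ≤ ⟦ adjacentIn (W ∖ v) x y ⟧ + (⟦ from-v x y ⟧ + ⟦ to-v x y ⟧)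
    split x y with x ≟ v | y ≟ v
    ... | yes _ | y≟v = ≤-trans (m≤m+n _ ⟦ does y≟v ∧ adjacentIn W x y ⟧)
                                (m≤n+m _ ⟦ (W x ∧ false) ∧ ((W y ∧ not (does y≟v)) ∧ adj x y) ⟧)
    ... | no _ | yes _ = m≤n+m _ _
    ... | no _ | no _ = ≤-trans (≤-reflexive (cong ⟦_⟧ (cong₂ (λ a b → a ∧ (b ∧ adj x y))
                                    (sym (∧-identityʳ (W x))) (sym (∧-identityʳ (W y))))))
                                (m≤m+n _ _)
    column : ∑[ x < n ] ∑[ y < n ] ⟦ to-v x y ⟧ ≡ degIn W v
    column = begin-equality
      ∑[ x < n ] ∑[ y < n ] ⟦ to-v x y ⟧                       ≡⟨ ∑-comm (λ x y → ⟦ to-v x y ⟧) ⟩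
      ∑[ y < n ] ∑[ x < n ] ⟦ does (y ≟ v) ∧ adjacentIn W x y ⟧ ≡⟨ sum-cong-≗ (λ y → sum-cong-≗ (λ x →
                                                                     cong (λ b → ⟦ does (y ≟ v) ∧ b ⟧) (adjacentIn-sym W x y))) ⟩
      ∑[ y < n ] ∑[ x < n ] ⟦ from-v y x ⟧                     ≡⟨ pairs-through W Wv ⟩
      degIn W v                                                 ∎

  module _ (noIsolated : NoIsolated F) where

    neighbour : ∀ v → ∃ λ u → Adj F v u
    neighbour v = count-witness (adj v) (subst (0 <_) (deg≡count v) (n≢0⇒n>0 (noIsolated v)))

    ¬deg≥2⇒leaf : ∀ {v} → ¬ T (isDeg≥2 v) → T (isLeaf F v)
    ¬deg≥2⇒leaf {v} ¬deg≥2 = does-complete (deg F v ≟ℕ 1)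
      (≤-antisym (≤-pred (≰⇒> (¬deg≥2 ∘ does-complete (2 ≤? deg F v)))) (n≢0⇒n>0 (noIsolated v)))

    lost-private-neighbour : ∀ {D D′ v} → (∀ u → T (D u) → u ≢ v → T (D′ u)) →
                             Dominatingᵇ D → ¬ Dominatingᵇ D′ → ∃ λ y → Adj F v y × ¬ T (D′ y)
    lost-private-neighbour {D} {D′} {v} kept dom ¬dom′
      with ¬∀⟶∃¬ n _ (λ w → T? (D′ w) ⊎-dec any? (λ u → T? (D′ u) ×-dec T? (adj u w))) ¬dom′
    ... | w , undominated with dom w | w ≟ v
    ...   | inj₁ Dw | no w≢v = ⊥-elim (undominated (inj₁ (kept w Dw w≢v)))
    ...   | inj₁ _ | yes refl =
            let (y , vy) = neighbour v in y , vy , λ D′y → undominated (inj₂ (y , D′y , Adj-sym vy))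
    ...   | inj₂ (u , Du , uw) | _ with u ≟ v
    ...     | no u≢v = ⊥-elim (undominated (inj₂ (u , kept u Du u≢v , uw)))
    ...     | yes refl = w , uw , λ D′w → undominated (inj₁ D′w)

    -- The upper bound

    isCore : Fin n → Bool
    isCore v = isDeg≥2 v ∧ isSupport F v

    isOuterLeaf : Fin n → Bool
    isOuterLeaf v = isLeaf F v ∧ not (isSupport F v)

    isFree : Fin n → Bool
    isFree v = not (isCore v) ∧ not (isOuterLeaf v)

    outerLeaf-dominated-by-core : ∀ {v} → T (isOuterLeaf v) → ∃ λ u → T (isCore u) × Adj F u v
    outerLeaf-dominated-by-core {v} outer with neighbour v
    ... | u , vu with T? (isDeg≥2 u)
    ...   | yes deg≥2 = u , ∧-intro deg≥2 (leaf-neighbour⇒support (Adj-sym vu) (∧-elimˡ outer)) , Adj-sym vu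
    ...   | no ¬deg≥2 = ⊥-elim (not-elim (∧-elimʳ {isLeaf F v} outer)
                                          (leaf-neighbour⇒support vu (¬deg≥2⇒leaf ¬deg≥2)))

    free-neighbour-¬outerLeaf : ∀ {v y} → T (isFree v) → Adj F v y → ¬ T (isOuterLeaf y)
    free-neighbour-¬outerLeaf {v} {y} free vy outer =
      not-elim (∧-elimʳ {isLeaf F y} outer) (leaf-neighbour⇒support (Adj-sym vy) v-leaf)
      where
      v-leaf : T (isLeaf F v)
      v-leaf = ¬deg≥2⇒leaf λ deg≥2 →
        not-elim (∧-elimˡ free) (∧-intro deg≥2 (leaf-neighbour⇒support vy (∧-elimˡ outer)))

    D₁ D₂ : (Fin n → Bool) → Fin n → Bool
    D₁ X v = isCore v ∨ X v
    D₂ X v = isCore v ∨ (isFree v ∧ not (X v))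

    D₁-free-dominating : Dominatingᵇ (D₁ isFree)
    D₁-free-dominating v with T? (isCore v) | T? (isOuterLeaf v)
    ... | yes core | _ = inj₁ (∨-introˡ core)
    ... | no _ | yes outer = let (u , core , uv) = outerLeaf-dominated-by-core outer in
                             inj₂ (u , ∨-introˡ core , uv)
    ... | no ¬core | no ¬outer = inj₁ (∨-introʳ {isCore v} (∧-intro (not-intro ¬core) (not-intro ¬outer)))

    D₁-∖ : ∀ {X u v} → T (D₁ X u) → u ≢ v → T (D₁ (X ∖ v) u)
    D₁-∖ {X} {u} {v} D₁u u≢v with ∨-elim D₁u
    ... | inj₁ core = ∨-introˡ core
    ... | inj₂ Xu = ∨-introʳ {isCore u} (∧-intro Xu (not-intro (u≢v ∘ does-sound (u ≟ v))))

    free∖X⇒D₂ : ∀ {X y} → ¬ T (isCore y) → ¬ T (isOuterLeaf y) → ¬ T (X y) → T (D₂ X y)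
    free∖X⇒D₂ {y = y} ¬core ¬outer ¬Xy =
      ∨-introʳ {isCore y} (∧-intro (∧-intro (not-intro ¬core) (not-intro ¬outer)) (not-intro ¬Xy))

    D₂-dominating : ∀ {X} → X ⊆ isFree → Dominatingᵇ (D₁ X) →
                    (∀ v → T (X v) → ¬ Dominatingᵇ (D₁ (X ∖ v))) → Dominatingᵇ (D₂ X)
    D₂-dominating {X} X⊆free dom minimal v with T? (isCore v) | T? (isOuterLeaf v) | T? (X v)
    ... | yes core | _ | _ = inj₁ (∨-introˡ core)
    ... | no _ | yes outer | _ = let (u , core , uv) = outerLeaf-dominated-by-core outer in
                                 inj₂ (u , ∨-introˡ core , uv)
    ... | no ¬core | no ¬outer | no ¬Xv = inj₁ (free∖X⇒D₂ {X} ¬core ¬outer ¬Xv)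
    ... | no _ | no _ | yes Xv with lost-private-neighbour (λ u D₁u → D₁-∖ {X} D₁u) dom (minimal v Xv)
    ...   | y , vy , ¬D₁∖y = inj₂ (y , D₂y , Adj-sym vy)
      where
      X∖v : T (X y) → T ((X ∖ v) y)
      X∖v Xy = ∧-intro Xy (not-intro (Adj-irrefl vy ∘ sym ∘ does-sound (y ≟ v)))
      D₂y : T (D₂ X y)
      D₂y = free∖X⇒D₂ {X} (¬D₁∖y ∘ ∨-introˡ) (free-neighbour-¬outerLeaf (X⊆free v Xv) vy)
                          (¬D₁∖y ∘ ∨-introʳ {isCore y} ∘ X∖v)

    count-D₁+D₂ : ∀ {X} → X ⊆ isFree →
                  count (D₁ X) + count (D₂ X) ≡ count isDeg≥2 + count (isSupport F)
    count-D₁+D₂ {X} X⊆free = begin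
      count (D₁ X) + count (D₂ X)                      ≡⟨ ∑-distrib-+ (λ v → ⟦ D₁ X v ⟧) _ ⟨
      ∑[ v < n ] (⟦ D₁ X v ⟧ + ⟦ D₂ X v ⟧)               ≡⟨ sum-cong-≗ weight ⟩
      ∑[ v < n ] (⟦ isDeg≥2 v ⟧ + ⟦ isSupport F v ⟧)     ≡⟨ ∑-distrib-+ (λ v → ⟦ isDeg≥2 v ⟧) _ ⟩
      count isDeg≥2 + count (isSupport F)              ∎
      where
      open ≡-Reasoning
      -- a core vertex lies in both sets, an outer leaf in neither, and a free vertex in exactly one;
      -- a free vertex has degree ≥ 2 or is a support vertex, but not both
      table : ∀ d s l x → (T d → ¬ T l) → (¬ T d → T l) → (T x → T (not (d ∧ s) ∧ not (l ∧ not s))) →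
              ⟦ (d ∧ s) ∨ x ⟧ + ⟦ (d ∧ s) ∨ ((not (d ∧ s) ∧ not (l ∧ not s)) ∧ not x) ⟧ ≡ ⟦ d ⟧ + ⟦ s ⟧
      table true true _ _ _ _ _ = refl
      table true false true _ d⇒¬l _ _ = ⊥-elim (d⇒¬l _ _)
      table true false false true _ _ _ = refl
      table true false false false _ _ _ = refl
      table false _ false _ _ ¬d⇒l _ = ⊥-elim (¬d⇒l id)
      table false true true true _ _ _ = refl
      table false true true false _ _ _ = refl
      table false false true true _ _ x⇒free = ⊥-elim (x⇒free _)
      table false false true false _ _ _ = refl
      weight : ∀ v → ⟦ D₁ X v ⟧ + ⟦ D₂ X v ⟧ ≡ ⟦ isDeg≥2 v ⟧ + ⟦ isSupport F v ⟧
      weight v = table (isDeg≥2 v) (isSupport F v) (isLeaf F v) (X v) deg≥2⇒¬leaf ¬deg≥2⇒leaf (X⊆free v)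

    upper-bound : ∀ {γ} → IsDominationNumber F γ → 2 * γ ≤ numDeg≥2 F + numSupp F
    upper-bound {γ} (_ , γ-minimum) with minimal-subset (Dominatingᵇ ∘ D₁) (Dominatingᵇ? ∘ D₁) D₁-free-dominating
    ... | X , X⊆free , dom , minimal = begin
      2 * γ                                ≡⟨ cong (γ +_) (+-identityʳ γ) ⟩
      γ + γ                                ≤⟨ +-mono-≤ (γ≤count (D₁ X) dom)
                                                        (γ≤count (D₂ X) (D₂-dominating X⊆free dom minimal)) ⟩
      count (D₁ X) + count (D₂ X)          ≡⟨ count-D₁+D₂ X⊆free ⟩
      count isDeg≥2 + count (isSupport F)  ≡⟨ cong₂ _+_ numDeg≥2≡count numSupp≡count ⟨
      numDeg≥2 F + numSupp F               ∎
      where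
      open ≤-Reasoning
      γ≤count : ∀ D → Dominatingᵇ D → γ ≤ count D
      γ≤count D dom = subst (γ ≤_) (∣tabulate∣≡count D) (γ-minimum _ (Dominatingᵇ⇒Dominating dom))

-- Forests

AllPairs-++⁻ˡ : ∀ {A : Set} {R : A → A → Set} (xs : List A) {ys} → AllPairs R (xs ++ ys) → AllPairs R xs
AllPairs-++⁻ˡ [] _ = []
AllPairs-++⁻ˡ (x ∷ xs) (x~xs++ys ∷ xs++ys) = All.++⁻ˡ xs x~xs++ys ∷ AllPairs-++⁻ˡ xs xs++ys

Linked-++⁻ˡ : ∀ {A : Set} {R : A → A → Set} (xs : List A) {ys} → Linked R (xs ++ ys) → Linked R xs
Linked-++⁻ˡ [] _ = []
Linked-++⁻ˡ (x ∷ []) _ = [-]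
Linked-++⁻ˡ (x ∷ y ∷ xs) (xy ∷ y∷xs++ys) = xy ∷ Linked-++⁻ˡ (y ∷ xs) y∷xs++ys

module _ {n : ℕ} (F : Graph n) (forest : IsForest F) where
  open Graph F using (adj)
  open import Data.List.Membership.DecPropositional (_≟_ {n}) using (_∈?_)

  no-chord : ∀ {e a path u} → Unique (e ∷ a ∷ path) → Linked (Adj F) (e ∷ a ∷ path) →
             u ∈ˡ path → ¬ Adj F e u
  no-chord {e} {a} {path} {u} unique linked u∈path eu with ∈-∃++ u∈path
  ... | pre , post , refl = forest (e , a ∷ pre , u , s≤s z≤n ,
                                    AllPairs-++⁻ˡ (e ∷ a ∷ pre ++ [ u ]) (subst Unique reassoc unique) ,
                                    Linked-++⁻ˡ (e ∷ a ∷ pre ++ [ u ]) (subst (Linked (Adj F)) reassoc linked) ,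
                                    Adj-sym F eu)
    where
    reassoc : e ∷ a ∷ pre ++ [ u ] ++ post ≡ (e ∷ a ∷ pre ++ [ u ]) ++ post
    reassoc = cong (λ xs → e ∷ a ∷ xs) (sym (++-assoc pre [ u ] post))

  path-neighbour-unique : ∀ {e path u u′} → Unique (e ∷ path) → Linked (Adj F) (e ∷ path) →
                          u ∈ˡ path → u′ ∈ˡ path → Adj F e u → Adj F e u′ → u ≡ u′
  path-neighbour-unique _ _ (here refl) (here refl) _ _ = refl
  path-neighbour-unique unique linked (there u∈path) _ eu _ = ⊥-elim (no-chord unique linked u∈path eu)
  path-neighbour-unique unique linked _ (there u′∈path) _ eu′ = ⊥-elim (no-chord unique linked u′∈path eu′)

  offPath : (Fin n → Bool) → List (Fin n) → ℕ
  offPath W path = count (λ x → W x ∧ not (does (x ∈? path)))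

  offPath-∷ : ∀ W {u path} → T (W u) → u ∉ˡ path → offPath W (u ∷ path) < offPath W path
  offPath-∷ W {u} {path} Wu u∉path =
    sum-mono-< (λ x → ⟦⟧-mono (shrinks x)) u (subst₂ _<_ (sym leaves) (sym stays) ≤-refl)
    where
    shrinks : ∀ x → T (W x ∧ not (does (x ∈? u ∷ path))) → T (W x ∧ not (does (x ∈? path)))
    shrinks x h = ∧-intro (∧-elimˡ h) (not-intro (not-elim (∧-elimʳ {W x} h) ∘ does-complete (x ∈? u ∷ path)
                                                  ∘ there ∘ does-sound (x ∈? path)))
    leaves : ⟦ W u ∧ not (does (u ∈? u ∷ path)) ⟧ ≡ 0
    leaves = ⟦⟧≡0 (λ h → not-elim (∧-elimʳ {W u} h) (does-complete (u ∈? u ∷ path) (here refl)))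
    stays : ⟦ W u ∧ not (does (u ∈? path)) ⟧ ≡ 1
    stays = ⟦⟧≡1 (∧-intro Wu (not-intro (u∉path ∘ does-sound (u ∈? path))))

  -- Grow a path inside W at its head e. Once e has no W-neighbour off the path, acyclicity leaves
  -- its predecessor as its only possible W-neighbour.
  low-degree-vertex : ∀ W {v₀} → T (W v₀) → ∃ λ v → T (W v) × degIn F W v ≤ 1
  low-degree-vertex W {v₀} Wv₀ = extend v₀ [] Wv₀ ([] ∷ []) [-] (<-wellFounded _)
    where
    extend : ∀ e path → T (W e) → Unique (e ∷ path) → Linked (Adj F) (e ∷ path) →
             Acc _<_ (offPath W (e ∷ path)) → ∃ λ v → T (W v) × degIn F W v ≤ 1
    extend e path We unique linked (acc smaller)
      with any? (λ u → T? (W u ∧ adj e u) ×-dec ¬? (u ∈? e ∷ path))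
    ... | yes (u , Wu∧eu , u∉) =
          extend u (e ∷ path) (∧-elimˡ Wu∧eu) (¬Any⇒All¬ _ u∉ ∷ unique) (Adj-sym F (∧-elimʳ {W u} Wu∧eu) ∷ linked)
                 (smaller (offPath-∷ W (∧-elimˡ Wu∧eu) u∉))
    ... | no none = e , We , count-≤1 (λ u u′ h h′ →
          path-neighbour-unique unique linked (on-path h) (on-path h′) (∧-elimʳ {W u} h) (∧-elimʳ {W u′} h′))
      where
      on-path : ∀ {u} → T (W u ∧ adj e u) → u ∈ˡ path
      on-path {u} h with decidable-stable (u ∈? e ∷ path) (λ u∉ → none (u , h , u∉))
      ... | here refl = ⊥-elim (Adj-irrefl F (∧-elimʳ {W u} h) refl)
      ... | there u∈path = u∈path

  pairs≤2*count : ∀ W → pairs F W ≤ 2 * count W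
  pairs≤2*count W = bound W (<-wellFounded (count W))
    where
    bound : ∀ W → Acc _<_ (count W) → pairs F W ≤ 2 * count W
    bound W (acc smaller) with any? (T? ∘ W)
    ... | no none = ≤-trans (≤-reflexive (sum-zero (λ x → count-zero {p = adjacentIn F W x} (λ y → none ∘ (x ,_) ∘ ∧-elimˡ))))
                            z≤n
    ... | yes (_ , Ww) with low-degree-vertex W Ww
    ...   | v , Wv , degIn≤1 = begin
      pairs F W                                     ≤⟨ pairs-∖ F W Wv ⟩
      pairs F (W ∖ v) + (degIn F W v + degIn F W v) ≤⟨ +-mono-≤ (bound (W ∖ v) (smaller count∖<count))
                                                                (+-mono-≤ degIn≤1 degIn≤1) ⟩
      2 * count (W ∖ v) + 2                         ≡⟨ +-comm (2 * count (W ∖ v)) 2 ⟩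
      2 + 2 * count (W ∖ v)                         ≡⟨ *-suc 2 (count (W ∖ v)) ⟨
      2 * suc (count (W ∖ v))                       ≡⟨ cong (2 *_) (count-remove W Wv) ⟨
      2 * count W                                   ∎
      where
      open ≤-Reasoning
      count∖<count : count (W ∖ v) < count W
      count∖<count = ≤-reflexive (sym (count-remove W Wv))

-- The lower bound

module _ {n : ℕ} (F : Graph n) (noIsolated : NoIsolated F) {D : Fin n → Bool} (dom : Dominatingᵇ F D) where
  open Graph F using (adj)

  dominatesLeaf : Fin n → Bool
  dominatesLeaf v = does (any? (λ u → T? (adj v u ∧ (isLeaf F u ∧ D u))))

  D⁺ : Fin n → Bool
  D⁺ v = D v ∨ dominatesLeaf v

  isDeg≥2∩D⁺ isDeg≥2∖D⁺ isK₂End : Fin n → Bool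
  isDeg≥2∩D⁺ v = isDeg≥2 F v ∧ D⁺ v
  isDeg≥2∖D⁺ v = isDeg≥2 F v ∧ not (D⁺ v)
  isK₂End v = isLeaf F v ∧ isSupport F v

  leaf-in-D⇒D⁺ : ∀ {v u} → Adj F v u → T (isLeaf F u) → T (D u) → T (D⁺ v)
  leaf-in-D⇒D⁺ {v} {u} vu leaf Du =
    ∨-introʳ {D v} (does-complete (any? (λ u → T? (adj v u ∧ (isLeaf F u ∧ D u)))) (u , ∧-intro vu (∧-intro leaf Du)))

  support⇒D⁺ : ∀ {v} → T (isSupport F v) → T (D⁺ v)
  support⇒D⁺ {v} supp with support⇒leaf-neighbour F supp
  ... | u , vu , leaf with dom u
  ...   | inj₁ Du = leaf-in-D⇒D⁺ vu leaf Du
  ...   | inj₂ (w , Dw , wu) = ∨-introˡ (subst (T ∘ D) (leaf-neighbour-unique F leaf (Adj-sym F wu) (Adj-sym F vu)) Dw)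

  K₂End-partner : ∀ {v u} → T (isK₂End v) → Adj F v u → T (isK₂End u)
  K₂End-partner {v} {u} K₂v vu with support⇒leaf-neighbour F (∧-elimʳ {isLeaf F v} K₂v)
  ... | z , vz , z-leaf = ∧-intro u-leaf (leaf-neighbour⇒support F (Adj-sym F vu) (∧-elimˡ K₂v))
    where
    u-leaf : T (isLeaf F u)
    u-leaf = subst (T ∘ isLeaf F) (leaf-neighbour-unique F (∧-elimˡ K₂v) vz vu) z-leaf

  support-count : count (isSupport F) ≤ count isDeg≥2∩D⁺ + count isK₂End
  support-count = ≤-trans (sum-mono-≤ split) (≤-reflexive (∑-distrib-+ (λ v → ⟦ isDeg≥2∩D⁺ v ⟧) _))
    where
    split : ∀ v → ⟦ isSupport F v ⟧ ≤ ⟦ isDeg≥2∩D⁺ v ⟧ + ⟦ isK₂End v ⟧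
    split v with T? (isSupport F v) | T? (isDeg≥2 F v)
    ... | no ¬supp | _ = ≤-trans (≤-reflexive (⟦⟧≡0 ¬supp)) z≤n
    ... | yes supp | yes deg≥2 = ≤-trans (⟦⟧-mono (λ _ → ∧-intro deg≥2 (support⇒D⁺ supp))) (m≤m+n _ _)
    ... | yes supp | no ¬deg≥2 =
          ≤-trans (⟦⟧-mono (λ _ → ∧-intro (¬deg≥2⇒leaf F noIsolated ¬deg≥2) supp)) (m≤n+m _ _)

  deg≥2∩D⁺-count : count isDeg≥2∩D⁺ ≤ count (λ u → D u ∧ not (isK₂End u))
  deg≥2∩D⁺-count = double-count R (λ u → ⟦ D u ∧ not (isK₂End u) ⟧) covered load
    where
    R : Fin n → Fin n → Bool
    R v u = isDeg≥2∩D⁺ v ∧ (D u ∧ (does (u ≟ v) ∨ (adj v u ∧ isLeaf F u)))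

    covered : ∀ v → T (isDeg≥2∩D⁺ v) → ∃ λ u → T (R v u)
    covered v Xv with ∨-elim (∧-elimʳ {isDeg≥2 F v} Xv)
    ... | inj₁ Dv = v , ∧-intro Xv (∧-intro Dv (∨-introˡ (does-complete (v ≟ v) refl)))
    ... | inj₂ dl with does-sound (any? (λ u → T? (adj v u ∧ (isLeaf F u ∧ D u)))) dl
    ...   | u , vu∧leaf∧Du = u , ∧-intro Xv (∧-intro (∧-elimʳ {isLeaf F u} leaf∧Du)
                                                  (∨-introʳ {does (u ≟ v)} (∧-intro vu (∧-elimˡ leaf∧Du))))
      where
      vu : Adj F v u
      vu = ∧-elimˡ vu∧leaf∧Du
      leaf∧Du : T (isLeaf F u ∧ D u)
      leaf∧Du = ∧-elimʳ {adj v u} vu∧leaf∧Du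

    decode : ∀ {v u} → T (R v u) → T (isDeg≥2 F v) × T (D u) × (u ≡ v ⊎ Adj F v u × T (isLeaf F u))
    decode {v} {u} Rvu with ∧-elimʳ {isDeg≥2∩D⁺ v} Rvu
    ... | Du∧charge with ∨-elim (∧-elimʳ {D u} Du∧charge)
    ...   | inj₁ u≟v = ∧-elimˡ (∧-elimˡ Rvu) , ∧-elimˡ Du∧charge , inj₁ (does-sound (u ≟ v) u≟v)
    ...   | inj₂ vu∧leaf = ∧-elimˡ (∧-elimˡ Rvu) , ∧-elimˡ Du∧charge ,
                           inj₂ (∧-elimˡ {adj v u} vu∧leaf , ∧-elimʳ {adj v u} vu∧leaf)

    unique : ∀ {u} v v′ → T (R v u) → T (R v′ u) → v ≡ v′
    unique v v′ Rvu Rv′u with decode Rvu | decode Rv′u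
    ... | _ , _ , inj₁ refl | _ , _ , inj₁ refl = refl
    ... | deg≥2 , _ , inj₁ refl | _ , _ , inj₂ (_ , leaf) = ⊥-elim (deg≥2⇒¬leaf F deg≥2 leaf)
    ... | _ , _ , inj₂ (_ , leaf) | deg≥2 , _ , inj₁ refl = ⊥-elim (deg≥2⇒¬leaf F deg≥2 leaf)
    ... | _ , _ , inj₂ (vu , leaf) | _ , _ , inj₂ (v′u , _) = leaf-neighbour-unique F leaf (Adj-sym F vu) (Adj-sym F v′u)

    ¬K₂End : ∀ {v u} → T (R v u) → ¬ T (isK₂End u)
    ¬K₂End Rvu K₂u with decode Rvu
    ... | deg≥2 , _ , inj₁ refl = deg≥2⇒¬leaf F deg≥2 (∧-elimˡ K₂u)
    ... | deg≥2 , _ , inj₂ (vu , _) = deg≥2⇒¬leaf F deg≥2 (∧-elimˡ (K₂End-partner K₂u (Adj-sym F vu)))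

    load : ∀ u → count (λ v → R v u) ≤ ⟦ D u ∧ not (isK₂End u) ⟧
    load u = count-≤-⟦⟧ unique (λ v Rvu → ∧-intro (proj₁ (proj₂ (decode Rvu))) (not-intro (¬K₂End Rvu)))

  K₂End-count : count isK₂End ≤ count (λ u → D u ∧ isK₂End u) + count (λ u → D u ∧ isK₂End u)
  K₂End-count = ≤-trans (double-count R (λ u → ⟦ D u ∧ isK₂End u ⟧ + ⟦ D u ∧ isK₂End u ⟧) covered load)
                        (≤-reflexive (∑-distrib-+ (λ u → ⟦ D u ∧ isK₂End u ⟧) _))
    where
    R : Fin n → Fin n → Bool
    R v u = isK₂End v ∧ (D u ∧ (does (u ≟ v) ∨ adj v u))

    covered : ∀ v → T (isK₂End v) → ∃ λ u → T (R v u)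
    covered v K₂v with dom v
    ... | inj₁ Dv = v , ∧-intro K₂v (∧-intro Dv (∨-introˡ (does-complete (v ≟ v) refl)))
    ... | inj₂ (u , Du , uv) = u , ∧-intro K₂v (∧-intro Du (∨-introʳ {does (u ≟ v)} (Adj-sym F uv)))

    decode : ∀ {v u} → T (R v u) → T (isK₂End v) × T (D u) × (u ≡ v ⊎ Adj F v u)
    decode {v} {u} Rvu with ∧-elimʳ {isK₂End v} Rvu
    ... | Du∧charge with ∨-elim (∧-elimʳ {D u} Du∧charge)
    ...   | inj₁ u≟v = ∧-elimˡ Rvu , ∧-elimˡ Du∧charge , inj₁ (does-sound (u ≟ v) u≟v)
    ...   | inj₂ vu = ∧-elimˡ Rvu , ∧-elimˡ Du∧charge , inj₂ vu

    D∩K₂End : ∀ {v u} → T (R v u) → T (D u ∧ isK₂End u)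
    D∩K₂End Rvu with decode Rvu
    ... | K₂v , Du , inj₁ refl = ∧-intro Du K₂v
    ... | K₂v , Du , inj₂ vu = ∧-intro Du (K₂End-partner K₂v vu)

    neighbour-of : ∀ {v u} → T (R v u ∧ not (does (v ≟ u))) → Adj F v u
    neighbour-of {v} {u} h with decode (∧-elimˡ h)
    ... | _ , _ , inj₁ u≡v = ⊥-elim (not-elim (∧-elimʳ {R v u} h) (does-complete (v ≟ u) (sym u≡v)))
    ... | _ , _ , inj₂ vu = vu

    load : ∀ u → count (λ v → R v u) ≤ ⟦ D u ∧ isK₂End u ⟧ + ⟦ D u ∧ isK₂End u ⟧
    load u = begin
      count (λ v → R v u)
        ≡⟨ count-split (λ v → R v u) (λ v → does (v ≟ u)) ⟩
      count (λ v → R v u ∧ does (v ≟ u)) + count (λ v → R v u ∧ not (does (v ≟ u)))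
        ≤⟨ +-mono-≤ (≤-trans (≤-reflexive (count-at (λ v → R v u) u)) (⟦⟧-mono D∩K₂End))
                    (count-≤-⟦⟧ partner-unique (λ v → D∩K₂End ∘ ∧-elimˡ)) ⟩
      ⟦ D u ∧ isK₂End u ⟧ + ⟦ D u ∧ isK₂End u ⟧ ∎
      where
      open ≤-Reasoning
      partner-unique : ∀ v v′ → T (R v u ∧ not (does (v ≟ u))) → T (R v′ u ∧ not (does (v′ ≟ u))) → v ≡ v′
      partner-unique v v′ h h′ =
        leaf-neighbour-unique F (∧-elimˡ (∧-elimʳ {D u} (D∩K₂End (∧-elimˡ h))))
                              (Adj-sym F (neighbour-of h)) (Adj-sym F (neighbour-of h′))

  deg≥2∖D⁺-neighbours : ∀ {v} → T (isDeg≥2∖D⁺ v) → 2 ≤ degIn F (isDeg≥2 F) v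
  deg≥2∖D⁺-neighbours {v} Nv = begin
    2                      ≤⟨ does-sound (2 ≤? deg F v) (∧-elimˡ Nv) ⟩
    deg F v                ≡⟨ deg≡count F v ⟩
    count (adj v)          ≤⟨ count-mono {q = λ u → isDeg≥2 F u ∧ adj v u}
                                         (λ u vu → ∧-intro (neighbour-deg≥2 vu) vu) ⟩
    degIn F (isDeg≥2 F) v  ∎
    where
    open ≤-Reasoning
    neighbour-deg≥2 : ∀ {u} → Adj F v u → T (isDeg≥2 F u)
    neighbour-deg≥2 {u} vu with T? (isDeg≥2 F u)
    ... | yes deg≥2 = deg≥2
    ... | no ¬deg≥2 = ⊥-elim (not-elim (∧-elimʳ {isDeg≥2 F v} Nv)
                                       (support⇒D⁺ (leaf-neighbour⇒support F vu (¬deg≥2⇒leaf F noIsolated ¬deg≥2))))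

  deg≥2∖D⁺-dominated : ∀ {v} → T (isDeg≥2∖D⁺ v) → ∃ λ u → T (isDeg≥2∩D⁺ u) × Adj F u v
  deg≥2∖D⁺-dominated {v} Nv with dom v
  ... | inj₁ Dv = ⊥-elim (not-elim (∧-elimʳ {isDeg≥2 F v} Nv) (∨-introˡ Dv))
  ... | inj₂ (u , Du , uv) with T? (isDeg≥2 F u)
  ...   | yes deg≥2 = u , ∧-intro deg≥2 (∨-introˡ Du) , uv
  ...   | no ¬deg≥2 = ⊥-elim (not-elim (∧-elimʳ {isDeg≥2 F v} Nv)
                                       (leaf-in-D⇒D⁺ (Adj-sym F uv) (¬deg≥2⇒leaf F noIsolated ¬deg≥2) Du))

  crossEdge : Fin n → Fin n → Bool
  crossEdge v u = isDeg≥2∩D⁺ v ∧ (isDeg≥2∖D⁺ u ∧ adj v u)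

  crossEdge⇒adjacentIn : ∀ {v u} → T (crossEdge v u) → T (adjacentIn F (isDeg≥2 F) v u)
  crossEdge⇒adjacentIn {v} {u} Kvu =
    ∧-intro (∧-elimˡ {isDeg≥2 F v} (∧-elimˡ {isDeg≥2∩D⁺ v} Kvu))
            (∧-intro (∧-elimˡ {isDeg≥2 F u} (∧-elimˡ {isDeg≥2∖D⁺ u} Nu∧vu)) (∧-elimʳ {isDeg≥2∖D⁺ u} Nu∧vu))
    where
    Nu∧vu : T (isDeg≥2∖D⁺ u ∧ adj v u)
    Nu∧vu = ∧-elimʳ {isDeg≥2∩D⁺ v} Kvu

  deg≥2∖D⁺≤crossEdges : count isDeg≥2∖D⁺ ≤ ∑[ v < n ] count (crossEdge v)
  deg≥2∖D⁺≤crossEdges = double-count (λ u v → crossEdge v u) (λ v → count (crossEdge v))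
                  (λ u Nu → let (v , Xv , vu) = deg≥2∖D⁺-dominated Nu in v , ∧-intro Xv (∧-intro Nu vu))
                  (λ v → ≤-refl)

  adjacentIn-deg≥2-row : ∀ v → ⟦ isDeg≥2∖D⁺ v ⟧ + (⟦ isDeg≥2∖D⁺ v ⟧ + count (crossEdge v)) ≤
                               count (adjacentIn F (isDeg≥2 F) v)
  adjacentIn-deg≥2-row v with T? (isDeg≥2∩D⁺ v) | T? (isDeg≥2∖D⁺ v)
  ... | yes Xv | _ rewrite ⟦⟧≡0 (λ Nv → not-elim (∧-elimʳ {isDeg≥2 F v} Nv) (∧-elimʳ {isDeg≥2 F v} Xv)) =
        count-mono {p = crossEdge v} (λ u → crossEdge⇒adjacentIn)
  ... | no ¬Xv | yes Nv rewrite ⟦⟧≡1 Nv | count-zero {p = crossEdge v} (λ u → ¬Xv ∘ ∧-elimˡ) =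
        ≤-trans (deg≥2∖D⁺-neighbours Nv)
                (count-mono {q = adjacentIn F (isDeg≥2 F) v} (λ u → ∧-intro (∧-elimˡ {isDeg≥2 F v} Nv)))
  ... | no ¬Xv | no ¬Nv rewrite ⟦⟧≡0 ¬Nv | count-zero {p = crossEdge v} (λ u → ¬Xv ∘ ∧-elimˡ) = z≤n

  deg≥2∖D⁺-count : IsForest F → count isDeg≥2∖D⁺ ≤ 2 * count isDeg≥2∩D⁺
  deg≥2∖D⁺-count forest = +-cancelˡ-≤ (N + N) N (2 * X) (begin
    N + N + N
      ≡⟨ +-assoc N N N ⟩
    N + (N + N)
      ≤⟨ +-monoʳ-≤ N (+-monoʳ-≤ N deg≥2∖D⁺≤crossEdges) ⟩
    N + (N + ∑[ v < n ] count (crossEdge v))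
      ≡⟨ cong (N +_) (∑-distrib-+ (λ v → ⟦ isDeg≥2∖D⁺ v ⟧) (count ∘ crossEdge)) ⟨
    N + ∑[ v < n ] (⟦ isDeg≥2∖D⁺ v ⟧ + count (crossEdge v))
      ≡⟨ ∑-distrib-+ (λ v → ⟦ isDeg≥2∖D⁺ v ⟧) _ ⟨
    ∑[ v < n ] (⟦ isDeg≥2∖D⁺ v ⟧ + (⟦ isDeg≥2∖D⁺ v ⟧ + count (crossEdge v)))
      ≤⟨ sum-mono-≤ adjacentIn-deg≥2-row ⟩
    pairs F (isDeg≥2 F)
      ≤⟨ pairs≤2*count F forest (isDeg≥2 F) ⟩
    2 * count (isDeg≥2 F)
      ≡⟨ cong (2 *_) (count-split (isDeg≥2 F) D⁺) ⟩
    2 * (X + N)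
      ≡⟨ rearrange X N ⟩
    N + N + 2 * X ∎)
    where
    open ≤-Reasoning
    X N : ℕ
    X = count isDeg≥2∩D⁺
    N = count isDeg≥2∖D⁺
    rearrange : ∀ x m → 2 * (x + m) ≡ m + m + 2 * x
    rearrange = solve-∀

  deg≥2+support-count : IsForest F → count (isDeg≥2 F) + count (isSupport F) ≤ 4 * count D
  deg≥2+support-count forest = begin
    count (isDeg≥2 F) + count (isSupport F)
      ≡⟨ cong (_+ count (isSupport F)) (count-split (isDeg≥2 F) D⁺) ⟩
    (X + N) + count (isSupport F)
      ≤⟨ +-mono-≤ (+-monoʳ-≤ X (deg≥2∖D⁺-count forest)) support-count ⟩
    (X + 2 * X) + (X + P)
      ≤⟨ +-mono-≤ (+-mono-≤ X≤a (*-monoʳ-≤ 2 X≤a)) (+-mono-≤ X≤a K₂End-count) ⟩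
    (a + 2 * a) + (a + (b + b))
      ≤⟨ m≤m+n _ (b + b) ⟩
    (a + 2 * a) + (a + (b + b)) + (b + b)
      ≡⟨ rearrange a b ⟩
    4 * (b + a)
      ≡⟨ cong (4 *_) (count-split D isK₂End) ⟨
    4 * count D ∎
    where
    open ≤-Reasoning
    X N P a b : ℕ
    X = count isDeg≥2∩D⁺
    N = count isDeg≥2∖D⁺
    P = count isK₂End
    a = count (λ u → D u ∧ not (isK₂End u))
    b = count (λ u → D u ∧ isK₂End u)
    X≤a : X ≤ a
    X≤a = deg≥2∩D⁺-count
    rearrange : ∀ a b → (a + 2 * a) + (a + (b + b)) + (b + b) ≡ 4 * (b + a)
    rearrange = solve-∀

numDeg≥2+numSupp≤4∣D∣ : ∀ {n} (F : Graph n) → IsForest F → NoIsolated F → ∀ {D} → Dominating F D →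
                        numDeg≥2 F + numSupp F ≤ 4 * ∣ D ∣
numDeg≥2+numSupp≤4∣D∣ F forest noIsolated {D} dom =
  subst₂ _≤_ (sym (cong₂ _+_ (numDeg≥2≡count F) (numSupp≡count F))) (cong (4 *_) (sym (∣∣≡count-lookup D)))
    (deg≥2+support-count F noIsolated (Dominating⇒Dominatingᵇ F dom) forest)

theorem13 : ∀ {n : ℕ} (F : Graph n) → IsForest F → NoIsolated F →
            ∀ (γ : ℕ) → IsDominationNumber F γ →
            (numDeg≥2 F + numSupp F ≤ 4 * γ) × (2 * γ ≤ numDeg≥2 F + numSupp F)
theorem13 F forest noIsolated γ isγ@((D , dom , ∣D∣≡γ) , _) =
  subst (λ k → numDeg≥2 F + numSupp F ≤ 4 * k) ∣D∣≡γ (numDeg≥2+numSupp≤4∣D∣ F forest noIsolated dom) ,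
  upper-bound F noIsolated isγ
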